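{- (i) For every ASD $D$, $C(D)=\max_{\pi\in\mathcal{P}_D}\log|\pi|$. (ii) For all ASDs $D,D'$, $C(D\times D')=C(D)+C(D')$. (iii) For every ASD $D$ and every integer $k\ge1$, $C(D^{(k)})\le k\cdot C(D)$.
   Context: An ASD is a pair $D=(\mathcal{S}_D,\mathcal{P}_D)$ with $\mathcal{S}_D$ a finite set and $\mathcal{P}_D$ a finite (nonempty) family of set partitions of $\mathcal{S}_D$; $|\pi|$ is the number of blocks. For partitions, $\pi\preceq\pi'$ means every block of $\pi$ lies in a block of $\pi'$; $\wedge$ is the meet. For $\phi:\mathcal{S}\to\mathcal{S}'$ and a partition $\pi$ of $\mathcal{S}'$, $\pi\circ\phi$ is the partition of $\mathcal{S}$ where $x,y$ share a block iff $\phi(x),\phi(y)$ share a block of $\pi$. $D\le D'$ means there exist $\phi:\mathcal{S}_D\to\mathcal{S}_{D'}$, $\alpha:\mathcal{P}_D\to\mathcal{P}_{D'}$ with $\alpha(\pi)\circ\phi\preceq\pi$ for all $\pi$. For $m\in\mathbb{N}$, $C_m$ is the ASD with state space $\{1,\dots,m\}$ and partition set $\{\mathrm{id}_{\{1,\dots,m\}}\}$ (the partition into singletons). The storage capacity is $C(D)=\max\{\log m: m\in\mathbb{N}, C_m\le D\}$ (logarithm base 2). The direct product $D\times D'$ has state space $\mathcal{S}_D\times\mathcal{S}_{D'}$ and partitions $\pi\times\pi'=\{B\times B':B\in\pi,B'\in\pi'\}$ for $\pi\in\mathcal{P}_D,\pi'\in\mathcal{P}_{D'}$. $D^{(k)}$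 has state space $\mathcal{S}_D$ and partition set $\{\pi_1\wedge\cdots\wedge\pi_k:\pi_i\in\mathcal{P}_D\}$. -}

module Defs where

open import Level using (0ℓ)
open import Data.Nat using (ℕ; zero; suc; _≤_; _⊔_)
open import Data.Fin using (Fin; _<_; remQuot)
open import Data.Fin.Properties using (all?; _≟_; _<?_)
open import Data.Product using (Σ; ∃; _×_; _,_; proj₁; proj₂)
open import Data.Unit using (⊤; tt)
open import Data.List as List using (List; filter; allFin; length; lookup)
open import Data.List.NonEmpty as List⁺ using (List⁺; [_]; toList)
open import Relation.Nullary using (¬_; Dec; yes)
open import Relation.Nullary.Decidable using (_→-dec_; _×-dec_; ¬?)
open import Relation.Binary using (Rel; Decidable)
open import Relation.Binary.PropositionalEquality using (_≡_; refl; sym; trans)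

-- Set partitions of the finite set Fin n, given by their block relation
-- ("x and y lie in the same block"), a decidable equivalence relation.

record Partition (n : ℕ) : Set₁ where
  field
    _∼_   : Rel (Fin n) 0ℓ
    dec   : Decidable _∼_
    refl∼ : ∀ x → x ∼ x
    sym∼  : ∀ {x y} → x ∼ y → y ∼ x
    trans∼ : ∀ {x y z} → x ∼ y → y ∼ z → x ∼ z
open Partition public

IsRep : ∀ {n} → Partition n → Fin n → Set
IsRep π x = ∀ y → y < x → ¬ (_∼_ π y x)

isRep? : ∀ {n} (π : Partition n) → (x : Fin n) → Dec (IsRep π x)
isRep? π x = all? (λ y → (y <? x) →-dec ¬? (dec π y x))

-- |π| : the number of blocks ( = number of block representatives )
∣_∣ : ∀ {n} → Partition n → ℕ
∣_∣ {n} π = length (filter (isRep? π) (allFin n))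

_≼_ : ∀ {n} → Rel (Fin n) 0ℓ → Rel (Fin n) 0ℓ → Set
R ≼ R' = ∀ x y → R x y → R' x y

_∧ᵖ_ : ∀ {n} → Partition n → Partition n → Partition n
π ∧ᵖ σ = record
  { _∼_ = λ x y → _∼_ π x y × _∼_ σ x y
  ; dec = λ x y → dec π x y ×-dec dec σ x y
  ; refl∼ = λ x → refl∼ π x , refl∼ σ x
  ; sym∼ = λ (p , q) → sym∼ π p , sym∼ σ q
  ; trans∼ = λ (p , q) (p' , q') → trans∼ π p p' , trans∼ σ q q'
  }

topᵖ : ∀ {n} → Partition n
topᵖ = record { _∼_ = λ _ _ → ⊤ ; dec = λ _ _ → yes tt
              ; refl∼ = λ _ → tt ; sym∼ = λ _ → tt ; trans∼ = λ _ _ → tt }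

idᵖ : ∀ {n} → Partition n
idᵖ = record { _∼_ = _≡_ ; dec = _≟_ ; refl∼ = λ _ → refl ; sym∼ = sym ; trans∼ = trans }

record ASD : Set₁ where
  field
    size  : ℕ
    parts : List⁺ (Partition size)
open ASD public

Idx : ASD → Set
Idx D = Fin (length (toList (parts D)))

part : (D : ASD) → Idx D → Partition (size D)
part D i = lookup (toList (parts D)) i

_≤ᴬ_ : ASD → ASD → Set
D ≤ᴬ D' = Σ (Fin (size D) → Fin (size D')) λ φ →
          Σ (Idx D → Idx D') λ α →
          ∀ i → (λ x y → _∼_ (part D' (α i)) (φ x) (φ y)) ≼ _∼_ (part D i)

Cₘ : ℕ → ASD
Cₘ m = record { size = m ; parts = [ idᵖ ] }

-- m is the largest natural number with C_m ≤ D  (so that C(D) = log₂ m)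
IsCapNum : ASD → ℕ → Set
IsCapNum D m = (Cₘ m ≤ᴬ D) × (∀ m' → Cₘ m' ≤ᴬ D → m' ≤ m)

maxBlocks : ASD → ℕ
maxBlocks D = List.foldr _⊔_ 0 (List.map ∣_∣ (toList (parts D)))

-- direct product; state space S_D × S_D' encoded as Fin (size D * size D')
-- via the bijection remQuot

open import Data.Nat using (_*_)

_×ᵖ_ : ∀ {n n'} → Partition n → Partition n' → Partition (n * n')
_×ᵖ_ {n} {n'} π σ = record
  { _∼_ = λ s t → _∼_ π (proj₁ (rq s)) (proj₁ (rq t)) × _∼_ σ (proj₂ (rq s)) (proj₂ (rq t))
  ; dec = λ s t → dec π _ _ ×-dec dec σ _ _
  ; refl∼ = λ s → refl∼ π _ , refl∼ σ _
  ; sym∼ = λ (p , q) → sym∼ π p , sym∼ σ q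
  ; trans∼ = λ (p , q) (p' , q') → trans∼ π p p' , trans∼ σ q q'
  }
  where rq : Fin (n * n') → Fin n × Fin n'
        rq = remQuot n'

_×ᴬ_ : ASD → ASD → ASD
D ×ᴬ D' = record
  { size = size D * size D'
  ; parts = List⁺.concatMap (λ π → List⁺.map (λ σ → π ×ᵖ σ) (parts D')) (parts D) }

-- D^(k): all meets π₁ ∧ ⋯ ∧ πₖ with πᵢ ∈ P_D  (k = 0 gives the empty meet)
meets : ∀ {n} → List⁺ (Partition n) → ℕ → List⁺ (Partition n)
meets P zero = [ topᵖ ]
meets P (suc k) = List⁺.concatMap (λ π → List⁺.map (λ σ → π ∧ᵖ σ) (meets P k)) P

_^⁽_⁾ : ASD → ℕ → ASD
D ^⁽ k ⁾ = record { size = size D ; parts = meets (parts D) k }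

module Submission where

-- Everything is reduced to two dual witnesses for a partition π of Fin n:
--   * a k-element SEPARATED family: k states in pairwise distinct blocks;
--   * a K-LABELLING: a map Fin n → Fin K whose fibres lie inside blocks.
-- By pigeonhole a separated family never outnumbers the labels, and the
-- canonical block representatives give both a separated family and a
-- labelling of size |π|.  Unfolding the definition of ≤ᴬ, C_k ≤ D just means
-- that some partition of D has a separated family of size k; hence D has
-- capacity number B as soon as one partition has a separated family of size B
-- and all partitions have a B-labelling.  Part (i) takes B = max |π|.
-- Separated families and labellings multiply under the product of
-- partitions, and labellings multiply under meets; this gives the lower and
-- upper bounds for part (ii) and, by induction on k, the bound of part (iii).

open import Defs
open import Data.Nat using (ℕ; _*_; _^_; _≤_)
open import Data.Product using (_×_)

open import Data.Nat using (suc; _⊔_; s≤s)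
open import Data.Nat.Properties
  using (≤-trans; ≤-reflexive; ≤-antisym; ⊔-sel; ⊔-identityʳ; m≤m⊔n; m≤n⊔m; *-mono-≤)
open import Data.Product using (Σ; ∃-syntax; _,_; proj₁; proj₂)
open import Data.Fin as Fin using (Fin; combine; remQuot; inject≤)
open import Data.Fin.Properties
  using (injective⇒≤; inject≤-injective; combine-injective; remQuot-combine; combine-remQuot; <-cmp)
open import Data.List as List using (List; []; _∷_; lookup; filter; allFin)
open import Data.List.NonEmpty as List⁺ using (List⁺; toList)
open import Data.List.Membership.Propositional using (_∈_)
open import Data.List.Membership.Propositional.Properties
  using (∈-lookup; ∈-filter⁺; ∈-filter⁻; ∈-allFin; ∈-cartesianProductWith⁺; ∈-cartesianProductWith⁻)
open import Data.List.Membership.Setoid.Properties using (index-injective)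
open import Data.List.Relation.Unary.Any as Any using (here; there)
open import Data.List.Relation.Unary.Any.Properties using (lookup-index)
import Data.List.Relation.Unary.All as All
open import Data.List.Relation.Unary.AllPairs using (_∷_)
open import Data.List.Relation.Unary.Unique.Propositional using (Unique)
import Data.List.Relation.Unary.Unique.Propositional.Properties as Unique
open import Data.Sum using (inj₁; inj₂)
open import Data.Unit using (tt)
open import Data.Empty using (⊥-elim)
open import Relation.Binary.Definitions using (tri<; tri≈; tri>)
open import Relation.Binary.PropositionalEquality
  using (_≡_; refl; sym; trans; cong; cong₂; subst; subst₂; setoid; module ≡-Reasoning)
open import Relation.Nullary using (¬_; Dec; yes; no)

Separated : ∀ {n} → Partition n → ℕ → Set
Separated {n} π k = Σ (Fin k → Fin n) λ f → ∀ i j → _∼_ π (f i) (f j) → i ≡ j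

Labelling : ∀ {n} → Partition n → ℕ → Set
Labelling {n} π K = Σ (Fin n → Fin K) λ c → ∀ x y → c x ≡ c y → _∼_ π x y

-- Pigeonhole: labelling a separated family is injective, so k ≤ K.
separated≤labels : ∀ {n} {π : Partition n} {k K} → Separated π k → Labelling π K → k ≤ K
separated≤labels (f , f-sep) (c , c-fib) =
  injective⇒≤ (λ {i} {j} ci≡cj → f-sep i j (c-fib (f i) (f j) ci≡cj))

separated-shrink : ∀ {n} {π : Partition n} {k k'} → k' ≤ k → Separated π k → Separated π k'
separated-shrink k'≤k (f , f-sep) =
  (λ i → f (inject≤ i k'≤k)) ,
  λ i j p → inject≤-injective k'≤k k'≤k i j (f-sep _ _ p)

labelling-widen : ∀ {n} {π : Partition n} {K K'} → K ≤ K' → Labelling π K → Labelling π K'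
labelling-widen K≤K' (c , c-fib) =
  (λ x → inject≤ (c x) K≤K') ,
  λ x y e → c-fib x y (inject≤-injective K≤K' K≤K' _ _ e)

least-witness : ∀ {n} (P : Fin n → Set) → (∀ x → Dec (P x)) → (x : Fin n) → P x →
                Σ (Fin n) λ y → P y × (∀ z → z Fin.< y → ¬ P z)
least-witness P P? Fin.zero p = Fin.zero , p , λ z ()
least-witness P P? (Fin.suc x) p with P? Fin.zero
... | yes p₀ = Fin.zero , p₀ , λ z ()
... | no ¬p₀ with least-witness (λ z → P (Fin.suc z)) (λ z → P? (Fin.suc z)) x p
...   | y , py , y-least =
  Fin.suc y , py , λ { Fin.zero _ → ¬p₀ ; (Fin.suc z) (s≤s z<y) → y-least z z<y }

lookup-injective : ∀ {a} {A : Set a} {xs : List A} → Unique xs →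
                   ∀ i j → lookup xs i ≡ lookup xs j → i ≡ j
lookup-injective (_ ∷ _) Fin.zero Fin.zero _ = refl
lookup-injective (x∉ ∷ _) Fin.zero (Fin.suc j) eq = ⊥-elim (All.lookup x∉ (∈-lookup j) eq)
lookup-injective (x∉ ∷ _) (Fin.suc i) Fin.zero eq = ⊥-elim (All.lookup x∉ (∈-lookup i) (sym eq))
lookup-injective (_ ∷ u) (Fin.suc i) (Fin.suc j) eq = cong Fin.suc (lookup-injective u i j eq)

module Representatives {n} (π : Partition n) where

  reps : List (Fin n)
  reps = filter (isRep? π) (allFin n)

  rep-unique : ∀ {x y} → IsRep π x → IsRep π y → _∼_ π x y → x ≡ y
  rep-unique {x} {y} x-rep y-rep x∼y with <-cmp x y
  ... | tri< x<y _ _ = ⊥-elim (y-rep x x<y x∼y)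
  ... | tri≈ _ x≡y _ = x≡y
  ... | tri> _ _ y<x = ⊥-elim (x-rep y y<x (sym∼ π x∼y))

  least-in-block : ∀ x → Σ (Fin n) λ y → _∼_ π y x × (∀ z → z Fin.< y → ¬ _∼_ π z x)
  least-in-block x = least-witness (λ y → _∼_ π y x) (λ y → dec π y x) x (refl∼ π x)

  rep : Fin n → Fin n
  rep x = proj₁ (least-in-block x)

  rep-∼ : ∀ x → _∼_ π (rep x) x
  rep-∼ x = proj₁ (proj₂ (least-in-block x))

  rep-isRep : ∀ x → IsRep π (rep x)
  rep-isRep x y y<r y∼r = proj₂ (proj₂ (least-in-block x)) y y<r (trans∼ π y∼r (rep-∼ x))

  rep∈reps : ∀ x → rep x ∈ reps
  rep∈reps x = ∈-filter⁺ (isRep? π) (∈-allFin (rep x)) (rep-isRep x)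

  blocks-separated : Separated π ∣ π ∣
  blocks-separated = lookup reps , λ i j p →
    lookup-injective (Unique.filter⁺ (isRep? π) (Unique.allFin⁺ n)) i j
      (rep-unique (isRep i) (isRep j) p)
    where
    isRep : ∀ i → IsRep π (lookup reps i)
    isRep i = proj₂ (∈-filter⁻ (isRep? π) {xs = allFin n} (∈-lookup {xs = reps} i))

  blocks-labelling : Labelling π ∣ π ∣
  blocks-labelling = (λ x → Any.index (rep∈reps x)) , λ x y same-index →
    let rx≡ry = index-injective (setoid (Fin n)) (rep∈reps x) (rep∈reps y) same-index
    in trans∼ π (sym∼ π (rep-∼ x)) (subst (λ z → _∼_ π z y) (sym rx≡ry) (rep-∼ y))

open Representatives using (blocks-separated; blocks-labelling)

Cₘ≤⇒separated : ∀ {D k} → Cₘ k ≤ᴬ D →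
                ∃[ ρ ] ρ ∈ toList (parts D) × Separated ρ k
Cₘ≤⇒separated {D} (φ , α , h) =
  part D (α Fin.zero) , ∈-lookup (α Fin.zero) , φ , h Fin.zero

separated⇒Cₘ≤ : ∀ {D k} {ρ : Partition (size D)} → ρ ∈ toList (parts D) →
                Separated ρ k → Cₘ k ≤ᴬ D
separated⇒Cₘ≤ {D} {k} {ρ} ρ∈ (f , f-sep) =
  f , (λ _ → Any.index ρ∈) , λ { Fin.zero x y p → f-sep x y (subst-sep p) }
  where
  subst-sep : ∀ {x y} → _∼_ (part D (Any.index ρ∈)) (f x) (f y) → _∼_ ρ (f x) (f y)
  subst-sep {x} {y} = subst (λ σ → _∼_ σ (f x) (f y)) (sym (lookup-index ρ∈))

capacity-bound : ∀ {D B k} → (∀ ρ → ρ ∈ toList (parts D) → Labelling ρ B) →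
                 Cₘ k ≤ᴬ D → k ≤ B
capacity-bound labels Ck≤D with Cₘ≤⇒separated Ck≤D
... | ρ , ρ∈ , sep = separated≤labels {π = ρ} sep (labels ρ ρ∈)

isCapNum-intro : ∀ {D B} {ρ : Partition (size D)} → ρ ∈ toList (parts D) → Separated ρ B →
                 (∀ σ → σ ∈ toList (parts D) → Labelling σ B) → IsCapNum D B
isCapNum-intro ρ∈ sep labels = separated⇒Cₘ≤ ρ∈ sep , λ k → capacity-bound labels

isCapNum-unique : ∀ {D m m'} → IsCapNum D m → IsCapNum D m' → m ≡ m'
isCapNum-unique (Cm≤D , m-max) (Cm'≤D , m'-max) = ≤-antisym (m'-max _ Cm≤D) (m-max _ Cm'≤D)

maxBlocksOf : ∀ {n} → List (Partition n) → ℕ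
maxBlocksOf ρs = List.foldr _⊔_ 0 (List.map ∣_∣ ρs)

blocks≤max : ∀ {n} {ρ : Partition n} {ρs} → ρ ∈ ρs → ∣ ρ ∣ ≤ maxBlocksOf ρs
blocks≤max {ρs = σ ∷ ρs} (here refl) = m≤m⊔n _ _
blocks≤max {ρs = σ ∷ ρs} (there ρ∈) = ≤-trans (blocks≤max ρ∈) (m≤n⊔m ∣ σ ∣ _)

max-attained : ∀ {n} (σ : Partition n) ρs →
               ∃[ ρ ] ρ ∈ σ ∷ ρs × maxBlocksOf (σ ∷ ρs) ≤ ∣ ρ ∣
max-attained σ [] = σ , here refl , ≤-reflexive (⊔-identityʳ ∣ σ ∣)
max-attained σ (τ ∷ ρs) with ⊔-sel ∣ σ ∣ (maxBlocksOf (τ ∷ ρs))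
... | inj₁ max≡σ = σ , here refl , ≤-reflexive max≡σ
... | inj₂ max≡rest with max-attained τ ρs
...   | ρ , ρ∈ , le = ρ , there ρ∈ , ≤-trans (≤-reflexive max≡rest) le

max-attained⁺ : ∀ {n} (ρs : List⁺ (Partition n)) →
                ∃[ ρ ] ρ ∈ toList ρs × maxBlocksOf (toList ρs) ≤ ∣ ρ ∣
max-attained⁺ (σ List⁺.∷ ρs) = max-attained σ ρs

labelling-maxBlocks : ∀ D ρ → ρ ∈ toList (parts D) → Labelling ρ (maxBlocks D)
labelling-maxBlocks D ρ ρ∈ = labelling-widen {π = ρ} (blocks≤max ρ∈) (blocks-labelling ρ)

capacity-maxBlocks : ∀ D → IsCapNum D (maxBlocks D)
capacity-maxBlocks D with max-attained⁺ (parts D)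
... | ρ , ρ∈ , max≤ρ =
  isCapNum-intro ρ∈ (separated-shrink {π = ρ} max≤ρ (blocks-separated ρ)) (labelling-maxBlocks D)

-- The partition lists of D ×ᴬ D' and D ^⁽ k ⁾ list all pairings g π σ, i.e.
-- they are the library's cartesianProductWith g.
toList-pairings : ∀ {a b c} {A : Set a} {B : Set b} {C : Set c} (g : A → B → C)
                  (P : List⁺ A) (Q : List⁺ B) →
                  toList (List⁺.concatMap (λ x → List⁺.map (g x) Q) P)
                  ≡ List.cartesianProductWith g (toList P) (toList Q)
toList-pairings g (x List⁺.∷ xs) Q = cong (List.map (g x) (toList Q) List.++_) (tail-pairings xs)
  where
  tail-pairings : ∀ ys → List.concat (List.map toList (List.map (λ y → List⁺.map (g y) Q) ys))
                         ≡ List.cartesianProductWith g ys (toList Q)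
  tail-pairings [] = refl
  tail-pairings (y ∷ ys) = cong (List.map (g y) (toList Q) List.++_) (tail-pairings ys)

∈-pairings⁺ : ∀ {a b c} {A : Set a} {B : Set b} {C : Set c} (g : A → B → C)
              {P : List⁺ A} {Q : List⁺ B} {x y} → x ∈ toList P → y ∈ toList Q →
              g x y ∈ toList (List⁺.concatMap (λ x → List⁺.map (g x) Q) P)
∈-pairings⁺ g {P} {Q} {x} {y} x∈ y∈ =
  subst (g x y ∈_) (sym (toList-pairings g P Q)) (∈-cartesianProductWith⁺ g x∈ y∈)

∈-pairings⁻ : ∀ {a b c} {A : Set a} {B : Set b} {C : Set c} (g : A → B → C)
              {P : List⁺ A} {Q : List⁺ B} {z} →
              z ∈ toList (List⁺.concatMap (λ x → List⁺.map (g x) Q) P) →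
              ∃[ x ] ∃[ y ] x ∈ toList P × y ∈ toList Q × z ≡ g x y
∈-pairings⁻ g {P} {Q} {z} z∈ =
  ∈-cartesianProductWith⁻ g (toList P) (toList Q) (subst (z ∈_) (toList-pairings g P Q) z∈)

product-separated : ∀ {n n'} {π : Partition n} {σ : Partition n'} {k k'} →
                    Separated π k → Separated σ k' → Separated (π ×ᵖ σ) (k * k')
product-separated {n} {n'} {π} {σ} {k} {k'} (f , f-sep) (g , g-sep) = fg , fg-sep
  where
  fg : Fin (k * k') → Fin (n * n')
  fg z = combine (f (proj₁ (remQuot {k} k' z))) (g (proj₂ (remQuot {k} k' z)))

  fg-sep : ∀ z w → _∼_ (π ×ᵖ σ) (fg z) (fg w) → z ≡ w
  fg-sep z w (p , q) = begin
    z                                    ≡⟨ sym (combine-remQuot {k} k' z) ⟩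
    uncurried-combine (remQuot {k} k' z) ≡⟨ cong uncurried-combine same-coordinates ⟩
    uncurried-combine (remQuot {k} k' w) ≡⟨ combine-remQuot {k} k' w ⟩
    w                                    ∎
    where
    open ≡-Reasoning
    uncurried-combine : Fin k × Fin k' → Fin (k * k')
    uncurried-combine (i , j) = combine i j
    split = remQuot-combine {n} {n'}
    same-coordinates : remQuot {k} k' z ≡ remQuot {k} k' w
    same-coordinates = cong₂ _,_
      (f-sep _ _ (subst₂ (_∼_ π) (cong proj₁ (split _ _)) (cong proj₁ (split _ _)) p))
      (g-sep _ _ (subst₂ (_∼_ σ) (cong proj₂ (split _ _)) (cong proj₂ (split _ _)) q))

product-labelling : ∀ {n n'} {π : Partition n} {σ : Partition n'} {K K'} →
                    Labelling π K → Labelling σ K' → Labelling (π ×ᵖ σ) (K * K')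
product-labelling {n} {n'} {K = K} {K'} (c , c-fib) (d , d-fib) =
  (λ z → combine (c (proj₁ (remQuot {n} n' z))) (d (proj₂ (remQuot {n} n' z)))) ,
  λ z w e → let same = combine-injective {m = K} {n = K'} _ _ _ _ e
            in c-fib _ _ (proj₁ same) , d-fib _ _ (proj₂ same)

meet-labelling : ∀ {n} {π σ : Partition n} {K K'} →
                 Labelling π K → Labelling σ K' → Labelling (π ∧ᵖ σ) (K * K')
meet-labelling {K = K} {K'} (c , c-fib) (d , d-fib) =
  (λ x → combine (c x) (d x)) ,
  λ x y e → let same = combine-injective {m = K} {n = K'} _ _ _ _ e
            in c-fib _ _ (proj₁ same) , d-fib _ _ (proj₂ same)

capacity-product : ∀ D D' → IsCapNum (D ×ᴬ D') (maxBlocks D * maxBlocks D')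
capacity-product D D' with max-attained⁺ (parts D) | max-attained⁺ (parts D')
... | ρ , ρ∈ , max≤ρ | ρ' , ρ'∈ , max'≤ρ' =
  isCapNum-intro (∈-pairings⁺ _×ᵖ_ ρ∈ ρ'∈)
    (separated-shrink {π = ρ ×ᵖ ρ'} (*-mono-≤ max≤ρ max'≤ρ')
      (product-separated {π = ρ} {σ = ρ'} (blocks-separated ρ) (blocks-separated ρ')))
    labels
  where
  labels : ∀ τ → τ ∈ toList (parts (D ×ᴬ D')) → Labelling τ (maxBlocks D * maxBlocks D')
  labels τ τ∈ =
    let σ , σ' , σ∈ , σ'∈ , τ≡σ×σ' = ∈-pairings⁻ _×ᵖ_ τ∈
    in subst (λ υ → Labelling υ _) (sym τ≡σ×σ')
         (product-labelling {π = σ} {σ = σ'} (labelling-maxBlocks D σ σ∈) (labelling-maxBlocks D' σ' σ'∈))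

meets-labelling : ∀ {n} (P : List⁺ (Partition n)) k ρ → ρ ∈ toList (meets P k) →
                  Labelling ρ (maxBlocksOf (toList P) ^ k)
meets-labelling P 0 ρ (here refl) = (λ _ → Fin.zero) , λ _ _ _ → tt
meets-labelling P (suc k) ρ ρ∈ with ∈-pairings⁻ _∧ᵖ_ {P = P} {Q = meets P k} ρ∈
... | π , σ , π∈ , σ∈ , refl =
  meet-labelling {π = π} {σ = σ} (labelling-widen {π = π} (blocks≤max π∈) (blocks-labelling π))
                 (meets-labelling P k σ σ∈)

proposition3 :
    (∀ (D : ASD) → IsCapNum D (maxBlocks D))
    × (∀ (D D' : ASD) (m m' : ℕ) → IsCapNum D m → IsCapNum D' m' → IsCapNum (D ×ᴬ D') (m * m'))
    × (∀ (D : ASD) (k : ℕ) → 1 ≤ k → (m mₖ : ℕ) → IsCapNum D m → IsCapNum (D ^⁽ k ⁾) mₖ → mₖ ≤ m ^ k)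
proposition3 = capacity-maxBlocks , product-additive , meet-subadditive
  where
  product-additive : ∀ (D D' : ASD) (m m' : ℕ) → IsCapNum D m → IsCapNum D' m' →
                     IsCapNum (D ×ᴬ D') (m * m')
  product-additive D D' m m' cap cap' =
    subst₂ (λ a b → IsCapNum (D ×ᴬ D') (a * b))
      (isCapNum-unique (capacity-maxBlocks D) cap)
      (isCapNum-unique (capacity-maxBlocks D') cap')
      (capacity-product D D')

  -- The bound holds for every k.
  meet-subadditive : ∀ (D : ASD) (k : ℕ) → 1 ≤ k → (m mₖ : ℕ) → IsCapNum D m →
                     IsCapNum (D ^⁽ k ⁾) mₖ → mₖ ≤ m ^ k
  meet-subadditive D k _ m mₖ cap (Cmₖ≤Dᵏ , _) =
    subst (λ a → mₖ ≤ a ^ k) (isCapNum-unique (capacity-maxBlocks D) cap)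
      (capacity-bound (meets-labelling (parts D) k) Cmₖ≤Dᵏ)
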